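{- Let $R$ be a commutative ring with unity and let $\mathcal{E}_{R}$ be its essential ideal graph. Then the metric dimension $\dim(\mathcal{E}_{R})$ is finite if and only if every vertex of $\mathcal{E}_{R}$ has finite degree.
   Context: An ideal of $R$ is essential if it has nonzero intersection with every nonzero ideal of $R$. The essential ideal graph $\mathcal{E}_{R}$ is the simple graph whose vertex set is the set of all nonzero proper ideals of $R$, two distinct vertices $\hat I,\hat J$ being adjacent iff $\hat I+\hat J$ is an essential ideal of $R$; it is connected (of diameter at most $3$). For an ordered set $W=\{w_1,\dots,w_k\}$ of vertices of a connected graph $\Gamma$ and a vertex $v$, $r(v\mid W)=(d(v,w_1),\dots,d(v,w_k))$, where $d$ is the graph distance. $W$ is a resolving set if $r(u\mid W)\neq r(v\mid W)$ for all distinct $u,v\in V(\Gamma)\setminus W$. The metric dimension $\dim(\Gamma)$ is the minimum cardinality of a resolving set. -}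

module Defs where

open import Level using (Level; _⊔_) renaming (suc to lsuc)
open import Algebra.Bundles using (CommutativeRing)
open import Data.Nat using (ℕ; zero; suc; _<_)
open import Data.List using (List)
open import Data.List.Relation.Unary.Any using (Any)
open import Data.Product using (Σ; ∃; ∃-syntax; _×_; _,_)
open import Relation.Nullary using (¬_)
open import Relation.Binary.PropositionalEquality using (_≢_)
import Algebra.Properties.CommutativeSemigroup as CSProps
import Algebra.Properties.AbelianGroup as AGProps

module EssentialIdealGraph {c ℓ : Level} (R : CommutativeRing c ℓ) where

  open CommutativeRing R

  record Ideal : Set (lsuc (c ⊔ ℓ)) where
    field
      mem      : Carrier → Set (c ⊔ ℓ)
      mem-resp : ∀ {x y} → x ≈ y → mem x → mem y
      mem-0    : mem 0#
      mem-+    : ∀ {x y} → mem x → mem y → mem (x + y)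
      mem--    : ∀ {x} → mem x → mem (- x)
      mem-*    : ∀ r {x} → mem x → mem (r * x)
  open Ideal public

  _≐_ : Ideal → Ideal → Set (c ⊔ ℓ)
  I ≐ J = ∀ x → (mem I x → mem J x) × (mem J x → mem I x)

  NonzeroIdeal : Ideal → Set (c ⊔ ℓ)
  NonzeroIdeal I = ∃[ x ] (mem I x × ¬ (x ≈ 0#))

  ProperIdeal : Ideal → Set (c ⊔ ℓ)
  ProperIdeal I = ¬ (mem I 1#)

  _⊕_ : Ideal → Ideal → Ideal
  I ⊕ J = record
    { mem = λ x → ∃[ a ] ∃[ b ] (mem I a × mem J b × x ≈ a + b)
    ; mem-resp = λ { x≈y (a , b , a∈ , b∈ , e) → a , b , a∈ , b∈ , trans (sym x≈y) e }
    ; mem-0 = 0# , 0# , mem-0 I , mem-0 J , sym (+-identityʳ 0#)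
    ; mem-+ = λ { (a , b , a∈ , b∈ , e) (a' , b' , a'∈ , b'∈ , e') →
        a + a' , b + b' , mem-+ I a∈ a'∈ , mem-+ J b∈ b'∈ ,
        trans (+-cong e e') (CSProps.interchange +-commutativeSemigroup a b a' b') }
    ; mem-- = λ { (a , b , a∈ , b∈ , e) →
        - a , - b , mem-- I a∈ , mem-- J b∈ ,
        trans (-‿cong e) (sym (AGProps.⁻¹-∙-comm +-abelianGroup a b)) }
    ; mem-* = λ { r (a , b , a∈ , b∈ , e) →
        r * a , r * b , mem-* I r a∈ , mem-* J r b∈ ,
        trans (*-cong refl e) (distribˡ r a b) }
    }

  Essential : Ideal → Set (lsuc (c ⊔ ℓ))
  Essential I = ∀ (K : Ideal) → NonzeroIdeal K →
    ∃[ x ] (mem I x × mem K x × ¬ (x ≈ 0#))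

  Vertex : Set (lsuc (c ⊔ ℓ))
  Vertex = Σ Ideal (λ I → NonzeroIdeal I × ProperIdeal I)

  ideal : Vertex → Ideal
  ideal (I , _) = I

  _≐v_ : Vertex → Vertex → Set (c ⊔ ℓ)
  u ≐v v = ideal u ≐ ideal v

  Adj : Vertex → Vertex → Set (lsuc (c ⊔ ℓ))
  Adj u v = ¬ (u ≐v v) × Essential (ideal u ⊕ ideal v)

  Walk : Vertex → Vertex → ℕ → Set (lsuc (c ⊔ ℓ))
  Walk u v zero    = Level.Lift (lsuc (c ⊔ ℓ)) (u ≐v v)
  Walk u v (suc n) = ∃[ w ] (Adj u w × Walk w v n)

  Dist : Vertex → Vertex → ℕ → Set (lsuc (c ⊔ ℓ))
  Dist u v n = Walk u v n × (∀ m → m < n → ¬ Walk u v m)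

  _∈V_ : Vertex → List Vertex → Set (lsuc (c ⊔ ℓ))
  u ∈V W = Any (λ w → Level.Lift (lsuc (c ⊔ ℓ)) (u ≐v w)) W

  Resolving : List Vertex → Set (lsuc (c ⊔ ℓ))
  Resolving W = ∀ u v → ¬ (u ∈V W) → ¬ (v ∈V W) → ¬ (u ≐v v) →
    Any (λ w → ∃[ m ] ∃[ n ] (Dist u w m × Dist v w n × m ≢ n)) W

  FiniteMetricDimension : Set (lsuc (c ⊔ ℓ))
  FiniteMetricDimension = ∃[ W ] Resolving W

  FiniteDegree : Vertex → Set (lsuc (c ⊔ ℓ))
  FiniteDegree v = ∃[ L ] (∀ u → Adj v u → u ∈V L)

-- Both conditions amount to finiteness of the graph, because its diameter is at most 3.
-- If u + v is not essential then Ann u and Ann v are nonzero, and since I + Ann I is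
-- essential for every ideal I, u is joined to v through Ann u + Ann v, or through Ann u and
-- Ann v when that sum is all of R. Hence with finite degrees every vertex lies within
-- distance 3 of a fixed one, and a finite resolving set W admits only 4^|W| distance
-- vectors, each realised by at most one vertex outside W. Conversely the vertex set of a
-- finite graph resolves it, and its degrees are finite.
module Submission where

open import Defs
open import Level using (Level; _⊔_; Lift; lift) renaming (suc to lsuc)
open import Algebra.Bundles using (CommutativeRing)
open import Axiom.ExcludedMiddle using (ExcludedMiddle)
open import Data.Product using (_×_; ∃-syntax; _,_; proj₁; proj₂)
open import Data.Nat using (ℕ; zero; suc; _≤_; _<_; z≤n; s≤s; s≤s⁻¹)
open import Data.Nat.Properties using (m≤n⇒m≤1+n; <-cmp; <-≤-trans)
open import Data.List using (List; []; _∷_; _++_; concat; concatMap; iterate; applyUpTo)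
open import Data.List.Relation.Unary.Any using (Any; here; there)
import Data.List.Relation.Unary.Any as Any
open import Data.List.Relation.Unary.All using (All; []; _∷_)
open import Data.List.Relation.Unary.Any.Properties using (++⁺ˡ; ++⁺ʳ; concat⁺; map⁺; applyUpTo⁺)
open import Data.Empty using (⊥-elim)
open import Relation.Nullary using (¬_; yes; no)
open import Relation.Binary.PropositionalEquality using (_≡_; _≢_)
import Relation.Binary.PropositionalEquality as ≡
open import Relation.Binary using (tri<; tri≈; tri>)
import Algebra.Properties.Ring as RingProperties

module Classical (lem : ∀ {a} → ExcludedMiddle a) where

  least-below : ∀ {a} (P : ℕ → Set a) n → ∃[ k ] (k ≤ n × P k) →
                ∃[ m ] (m ≤ n × P m × (∀ j → j < m → ¬ P j))
  least-below P zero (zero , z≤n , p) = zero , z≤n , p , λ _ ()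
  least-below P (suc n) (k , k≤1+n , p) with lem {P = ∃[ j ] (j ≤ n × P j)}
  ... | yes below with least-below P n below
  ...   | m , m≤n , pm , minimal = m , m≤n⇒m≤1+n m≤n , pm , minimal
  least-below P (suc n) (k , k≤1+n , p) | no ¬below =
    k , k≤1+n , p , λ j j<k pj → ¬below (j , s≤s⁻¹ (<-≤-trans j<k k≤1+n) , pj)

  module EssentialIdealGraphProperties {c ℓ : Level} (R : CommutativeRing c ℓ) where
    open CommutativeRing R hiding (zero)
    open EssentialIdealGraph R
    open RingProperties ring using (-‿distribˡ-*; -0#≈0#)

    record _⊆_ (I J : Ideal) : Set (c ⊔ ℓ) where
      constructor ⟨_⟩
      field ⊆-mem : ∀ x → mem I x → mem J x
    open _⊆_

    ⊆-refl : ∀ {I} → I ⊆ I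
    ⊆-refl = ⟨ (λ _ x∈I → x∈I) ⟩

    ⊕-mono : ∀ {I I′ J J′} → I ⊆ I′ → J ⊆ J′ → (I ⊕ J) ⊆ (I′ ⊕ J′)
    ⊕-mono I⊆I′ J⊆J′ = ⟨ (λ { x (a , b , a∈I , b∈J , x≈a+b) →
      a , b , ⊆-mem I⊆I′ a a∈I , ⊆-mem J⊆J′ b b∈J , x≈a+b }) ⟩

    ⊕-comm : ∀ {I J} → (I ⊕ J) ⊆ (J ⊕ I)
    ⊕-comm = ⟨ (λ { x (a , b , a∈I , b∈J , x≈a+b) →
      b , a , b∈J , a∈I , trans x≈a+b (+-comm a b) }) ⟩

    ⊆-⊕ˡ : ∀ {I J} → I ⊆ (I ⊕ J)
    ⊆-⊕ˡ {J = J} = ⟨ (λ x x∈I → x , 0# , x∈I , mem-0 J , sym (+-identityʳ x)) ⟩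

    ⊆-⊕ʳ : ∀ {I J} → J ⊆ (I ⊕ J)
    ⊆-⊕ʳ {I = I} = ⟨ (λ x x∈J → 0# , x , mem-0 I , x∈J , sym (+-identityˡ x)) ⟩

    ⊆-zero : ∀ {I} J → ¬ NonzeroIdeal I → I ⊆ J
    ⊆-zero J I≡0 = ⟨ (λ x x∈I → x∈J x x∈I) ⟩
      where
      x∈J : ∀ x → _ → mem J x
      x∈J x x∈I with lem {P = x ≈ 0#}
      ... | yes x≈0 = mem-resp J (sym x≈0) (mem-0 J)
      ... | no x≉0  = ⊥-elim (I≡0 (x , x∈I , x≉0))

    Essential-mono : ∀ {I J} → I ⊆ J → Essential I → Essential J
    Essential-mono I⊆J ess K K≢0 with ess K K≢0
    ... | x , x∈I , x∈K , x≉0 = x , ⊆-mem I⊆J x x∈I , x∈K , x≉0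

    Essential-unit : ∀ {I} → mem I 1# → Essential I
    Essential-unit {I} 1∈I K (x , x∈K , x≉0) =
      x , mem-resp I (*-identityʳ x) (mem-* I x 1∈I) , x∈K , x≉0

    Ann : Ideal → Ideal
    Ann I = record
      { mem      = λ x → ∀ y → mem I y → x * y ≈ 0#
      ; mem-resp = λ x≈x′ kills y y∈I → trans (*-cong (sym x≈x′) refl) (kills y y∈I)
      ; mem-0    = λ y _ → zeroˡ y
      ; mem-+    = λ {x} {x′} kills kills′ y y∈I →
          trans (distribʳ y x x′) (trans (+-cong (kills y y∈I) (kills′ y y∈I)) (+-identityʳ 0#))
      ; mem--    = λ {x} kills y y∈I →
          trans (sym (-‿distribˡ-* x y)) (trans (-‿cong (kills y y∈I)) -0#≈0#)
      ; mem-*    = λ r {x} kills y y∈I →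
          trans (*-assoc r x y) (trans (*-cong refl (kills y y∈I)) (zeroʳ r))
      }

    Ann-proper : ∀ {I} → NonzeroIdeal I → ProperIdeal (Ann I)
    Ann-proper (x , x∈I , x≉0) 1∈Ann = x≉0 (trans (sym (*-identityˡ x)) (1∈Ann x x∈I))

    -- A nonzero x ∈ K either kills I, and then lies in Ann I, or has a nonzero multiple x y
    -- with y ∈ I, which lies in I ∩ K.
    ⊕-Ann-essential : ∀ I → Essential (I ⊕ Ann I)
    ⊕-Ann-essential I K (x , x∈K , x≉0) with lem {P = ∃[ y ] (mem I y × ¬ (x * y ≈ 0#))}
    ... | yes (y , y∈I , xy≉0) =
      x * y , ⊆-mem (⊆-⊕ˡ {I} {Ann I}) _ (mem-* I x y∈I) ,
      mem-resp K (*-comm y x) (mem-* K y x∈K) , xy≉0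
    ... | no ¬witness = x , ⊆-mem (⊆-⊕ʳ {I} {Ann I}) x x∈Ann , x∈K , x≉0
      where
      x∈Ann : mem (Ann I) x
      x∈Ann y y∈I with lem {P = x * y ≈ 0#}
      ... | yes xy≈0 = xy≈0
      ... | no xy≉0  = ⊥-elim (¬witness (y , y∈I , xy≉0))

    ¬Essential-⊕⇒Ann-nonzero : ∀ {I J} → ¬ Essential (I ⊕ J) → NonzeroIdeal (Ann I)
    ¬Essential-⊕⇒Ann-nonzero {I} {J} ¬ess with lem {P = NonzeroIdeal (Ann I)}
    ... | yes Ann≢0 = Ann≢0
    ... | no Ann≡0  = ⊥-elim (¬ess (Essential-mono (⊕-mono (⊆-refl {I}) (⊆-zero {Ann I} J Ann≡0))
                                                   (⊕-Ann-essential I)))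

    ≐v-refl : ∀ u → u ≐v u
    ≐v-refl u x = (λ x∈u → x∈u) , (λ x∈u → x∈u)

    ≐v-sym : ∀ {u v} → u ≐v v → v ≐v u
    ≐v-sym u≐v x = proj₂ (u≐v x) , proj₁ (u≐v x)

    ≐v-trans : ∀ {u v w} → u ≐v v → v ≐v w → u ≐v w
    ≐v-trans u≐v v≐w x = (λ x∈u → proj₁ (v≐w x) (proj₁ (u≐v x) x∈u))
                       , (λ x∈w → proj₂ (u≐v x) (proj₂ (v≐w x) x∈w))

    ≐v⇒⊆ : ∀ {u v} → u ≐v v → ideal u ⊆ ideal v
    ≐v⇒⊆ u≐v = ⟨ (λ x → proj₁ (u≐v x)) ⟩

    Adj-respˡ : ∀ {u v w} → u ≐v v → Adj v w → Adj u w
    Adj-respˡ {u} {v} {w} u≐v (v≢w , ess) =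
      (λ u≐w → v≢w (≐v-trans {v} {u} {w} (≐v-sym {u} {v} u≐v) u≐w)) ,
      Essential-mono (⊕-mono (≐v⇒⊆ {v} {u} (≐v-sym {u} {v} u≐v)) (⊆-refl {ideal w})) ess

    Walk-respˡ : ∀ n {u v w} → u ≐v v → Walk v w n → Walk u w n
    Walk-respˡ zero    {u} {v} {w} u≐v (lift v≐w) = lift (≐v-trans {u} {v} {w} u≐v v≐w)
    Walk-respˡ (suc n) {u} {v} u≐v (x , v~x , walk) = x , Adj-respˡ {u} {v} {x} u≐v v~x , walk

    ∈V-resp : ∀ {u v} W → u ≐v v → u ∈V W → v ∈V W
    ∈V-resp {u} {v} W u≐v = Any.map (λ {w} → λ { (lift u≐w) →
      lift (≐v-trans {v} {u} {w} (≐v-sym {u} {v} u≐v) u≐w) })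

    Reach : Vertex → Vertex → ℕ → Set (lsuc (c ⊔ ℓ))
    Reach u v k = ∃[ n ] (n ≤ k × Walk u v n)

    Reach-refl : ∀ v → Reach v v 0
    Reach-refl v = 0 , z≤n , lift (≐v-refl v)

    Reach-weaken : ∀ {u v k} → Reach u v k → Reach u v (suc k)
    Reach-weaken (n , n≤k , walk) = n , m≤n⇒m≤1+n n≤k , walk

    -- An essential sum joins u and v either as an edge or because u and v coincide.
    Reach-step : ∀ {u v w k} → Essential (ideal u ⊕ ideal v) → Reach v w k → Reach u w (suc k)
    Reach-step {u} {v} ess (n , n≤k , walk) with lem {P = u ≐v v}
    ... | yes u≐v = n , m≤n⇒m≤1+n n≤k , Walk-respˡ n u≐v walk
    ... | no u≢v  = suc n , s≤s n≤k , v , (u≢v , ess) , walk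

    diameter≤3 : ∀ u v → Reach u v 3
    diameter≤3 u v with lem {P = Essential (ideal u ⊕ ideal v)}
    ... | yes ess = Reach-weaken (Reach-weaken (Reach-step ess (Reach-refl v)))
    ... | no ¬ess = via-annihilators
      where
      A B : Ideal
      A = Ann (ideal u)
      B = Ann (ideal v)
      A≢0 : NonzeroIdeal A
      A≢0 = ¬Essential-⊕⇒Ann-nonzero {ideal u} {ideal v} ¬ess
      B≢0 : NonzeroIdeal B
      B≢0 = ¬Essential-⊕⇒Ann-nonzero {ideal v} {ideal u}
              (λ ess → ¬ess (Essential-mono (⊕-comm {ideal v} {ideal u}) ess))
      u⊕A-essential : Essential (ideal u ⊕ A)
      u⊕A-essential = ⊕-Ann-essential (ideal u)
      B⊕v-essential : Essential (B ⊕ ideal v)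
      B⊕v-essential = Essential-mono (⊕-comm {ideal v} {B}) (⊕-Ann-essential (ideal v))
      A⊕B≢0 : NonzeroIdeal (A ⊕ B)
      A⊕B≢0 = let (x , x∈A , x≉0) = A≢0 in x , ⊆-mem (⊆-⊕ˡ {A} {B}) x x∈A , x≉0
      via-annihilators : Reach u v 3
      via-annihilators with lem {P = mem (A ⊕ B) 1#}
      ... | no 1∉A⊕B =
        Reach-weaken (Reach-step {v = A ⊕ B , A⊕B≢0 , 1∉A⊕B}
          (Essential-mono (⊕-mono (⊆-refl {ideal u}) (⊆-⊕ˡ {A} {B})) u⊕A-essential)
          (Reach-step (Essential-mono (⊕-mono (⊆-⊕ʳ {A} {B}) (⊆-refl {ideal v})) B⊕v-essential)
            (Reach-refl v)))
      ... | yes 1∈A⊕B =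
        Reach-step {v = A , A≢0 , Ann-proper {ideal u} (proj₁ (proj₂ u))} u⊕A-essential
          (Reach-step {v = B , B≢0 , Ann-proper {ideal v} (proj₁ (proj₂ v))}
            (Essential-unit {A ⊕ B} 1∈A⊕B)
            (Reach-step B⊕v-essential (Reach-refl v)))

    Dist-unique : ∀ {u v m n} → Dist u v m → Dist u v n → m ≡ n
    Dist-unique {m = m} {n} (walk-m , minimal-m) (walk-n , minimal-n) with <-cmp m n
    ... | tri< m<n _ _ = ⊥-elim (minimal-n m m<n walk-m)
    ... | tri≈ _ m≡n _ = m≡n
    ... | tri> _ _ n<m = ⊥-elim (minimal-m n n<m walk-n)

    SameDistances : List Vertex → Vertex → Vertex → Set (lsuc (c ⊔ ℓ))
    SameDistances W u u′ = All (λ w → ∃[ n ] (Dist u w n × Dist u′ w n)) W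

    SameDistances⇒unresolved : ∀ {W u u′} → SameDistances W u u′ →
      ¬ Any (λ w → ∃[ m ] ∃[ n ] (Dist u w m × Dist u′ w n × m ≢ n)) W
    SameDistances⇒unresolved ((k , u-w , u′-w) ∷ _) (here (m , n , u-w′ , u′-w′ , m≢n)) =
      m≢n (≡.trans (Dist-unique u-w′ u-w) (Dist-unique u′-w u′-w′))
    SameDistances⇒unresolved (_ ∷ same) (there unresolved) = SameDistances⇒unresolved same unresolved

    FiniteGraph : Set (lsuc (c ⊔ ℓ))
    FiniteGraph = ∃[ L ] (∀ u → u ∈V L)

    finite⇒FiniteDegree : FiniteGraph → ∀ v → FiniteDegree v
    finite⇒FiniteDegree (L , all∈L) v = L , λ u _ → all∈L u

    finite⇒FiniteMetricDimension : FiniteGraph → FiniteMetricDimension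
    finite⇒FiniteMetricDimension (L , all∈L) = L , λ u _ u∉L _ _ → ⊥-elim (u∉L (all∈L u))

    module _ (degree : ∀ v → FiniteDegree v) where

      neighbours : List Vertex → List Vertex
      neighbours = concatMap (λ b → proj₁ (degree b))

      ∈-neighbours : ∀ {u x} B → u ∈V B → Adj u x → x ∈V neighbours B
      ∈-neighbours {u} {x} B u∈B u~x = concat⁺ (map⁺ (Any.map x∈degree u∈B))
        where
        x∈degree : ∀ {b} → Lift _ (u ≐v b) → x ∈V proj₁ (degree b)
        x∈degree {b} (lift u≐b) =
          proj₂ (degree b) x (Adj-respˡ {b} {u} {x} (≐v-sym {u} {b} u≐b) u~x)

      ball : List Vertex → ℕ → List Vertex
      ball B r = concat (iterate neighbours B (suc r))

      Walk⇒∈ball : ∀ n r {u v} B → n ≤ r → u ∈V B → Walk u v n → v ∈V ball B r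
      Walk⇒∈ball zero r {u} {v} B _ u∈B (lift u≐v) = ++⁺ˡ (∈V-resp {u} {v} B u≐v u∈B)
      Walk⇒∈ball (suc n) (suc r) {u} B (s≤s n≤r) u∈B (x , u~x , walk) =
        ++⁺ʳ B (Walk⇒∈ball n r (neighbours B) n≤r (∈-neighbours {u} {x} B u∈B u~x) walk)

    module BoundedDiameter (d : ℕ) (diameter : ∀ u v → Reach u v d) where

      dist : ∀ u v → ∃[ n ] (n ≤ d × Dist u v n)
      dist u v with least-below (Walk u v) d (diameter u v)
      ... | n , n≤d , walk , minimal = n , n≤d , walk , minimal

      -- Split by the distance k ≤ d to w, and recurse on W inside each class.
      representatives : ∀ W (Q : Vertex → Set (lsuc (c ⊔ ℓ))) →
        ∃[ L ] (∀ u → Q u → Any (λ u′ → Q u′ × SameDistances W u u′) L)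
      representatives [] Q with lem {P = ∃[ u ] Q u}
      ... | yes (u₀ , Qu₀) = u₀ ∷ [] , λ _ _ → here (Qu₀ , [])
      ... | no ∄u         = [] , λ u Qu → ⊥-elim (∄u (u , Qu))
      representatives (w ∷ W) Q = concat (applyUpTo L (suc d)) , covered
        where
        AtDistance : ℕ → Vertex → Set (lsuc (c ⊔ ℓ))
        AtDistance k u = Q u × Dist u w k
        L : ℕ → List Vertex
        L k = proj₁ (representatives W (AtDistance k))
        covered : ∀ u → Q u →
          Any (λ u′ → Q u′ × SameDistances (w ∷ W) u u′) (concat (applyUpTo L (suc d)))
        covered u Qu with dist u w
        ... | k , k≤d , u-w = concat⁺ (applyUpTo⁺ L (Any.map extend in-class) (s≤s k≤d))
          where
          in-class : Any (λ u′ → AtDistance k u′ × SameDistances W u u′) (L k)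
          in-class = proj₂ (representatives W (AtDistance k)) u (Qu , u-w)
          extend : ∀ {u′} → AtDistance k u′ × SameDistances W u u′ →
                   Q u′ × SameDistances (w ∷ W) u u′
          extend ((Qu′ , u′-w) , same) = Qu′ , (k , u-w , u′-w) ∷ same

      Resolving⇒finite : ∀ {W} → Resolving W → FiniteGraph
      Resolving⇒finite {W} resolving = W ++ proj₁ outside , all∈
        where
        outside : ∃[ L ] (∀ u → ¬ (u ∈V W) → Any (λ u′ → ¬ (u′ ∈V W) × SameDistances W u u′) L)
        outside = representatives W (λ u → ¬ (u ∈V W))
        all∈ : ∀ u → u ∈V (W ++ proj₁ outside)
        all∈ u with lem {P = u ∈V W}
        ... | yes u∈W = ++⁺ˡ u∈W
        ... | no u∉W  = ++⁺ʳ W (Any.map represented (proj₂ outside u u∉W))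
          where
          represented : ∀ {u′} → ¬ (u′ ∈V W) × SameDistances W u u′ → Lift _ (u ≐v u′)
          represented {u′} (u′∉W , same) with lem {P = u ≐v u′}
          ... | yes u≐u′ = lift u≐u′
          ... | no u≢u′  = ⊥-elim (SameDistances⇒unresolved same (resolving u u′ u∉W u′∉W u≢u′))

      FiniteDegree⇒finite : (∀ v → FiniteDegree v) → FiniteGraph
      FiniteDegree⇒finite degree with lem {P = Vertex}
      ... | no ∄v  = [] , λ u → ⊥-elim (∄v u)
      ... | yes v₀ = ball degree (v₀ ∷ []) d , λ u →
        let (n , n≤d , walk) = diameter v₀ u
        in Walk⇒∈ball degree n d (v₀ ∷ []) n≤d (here (lift (≐v-refl v₀))) walk

mainTheorem1 : (lem : ∀ {a} → ExcludedMiddle a) →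
    ∀ {c ℓ : Level} (R : CommutativeRing c ℓ) →
    let open EssentialIdealGraph R in
    (FiniteMetricDimension → ∀ v → FiniteDegree v) ×
    ((∀ v → FiniteDegree v) → FiniteMetricDimension)
mainTheorem1 lem R =
  (λ (W , resolving) → finite⇒FiniteDegree (Resolving⇒finite resolving)) ,
  (λ degree → finite⇒FiniteMetricDimension (FiniteDegree⇒finite degree))
  where
  open Classical lem
  open EssentialIdealGraphProperties R
  open BoundedDiameter 3 diameter≤3
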